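{- Let $G$ be a finite, simple, connected graph with no induced house and no induced hole, and with no universal line. Then the set $\mathcal{L}_1=\{\overline{uv}: uv \text{ an edge of } G\}$ and the set $\mathcal{L}_2=\{\overline{uv}: u,v \text{ a good pair of } G\}$ are disjoint.
   Context: The house is a 5-cycle plus one chord; a hole is a cycle on at least five vertices. $d_G$ is the shortest-path distance. A vertex $z$ is between $a$ and $b$ if $d_G(a,b)=d_G(a,z)+d_G(z,b)$. For distinct $a,b$, the line $\overline{ab}$ is the set of all $z$ such that one of $a,b,z$ is between the other two; it is universal if it equals $V(G)$. A good pair is a pair $u,v$ with $d_G(u,v)=2$ having a common neighbour $c$ with $\overline{uc}=\overline{cv}$. -}

module Defs where

open import Data.Nat using (ℕ; zero; suc; _+_; _<_)
open import Data.Fin using (Fin; toℕ)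
open import Data.Product using (Σ; ∃; _×_; _,_)
open import Data.Sum using (_⊎_)
open import Data.Empty using (⊥)
open import Relation.Nullary using (¬_; Dec)
open import Relation.Binary.PropositionalEquality using (_≡_; _≢_)
open import Function.Bundles using (_⇔_)
open import Function.Definitions using (Injective)

record Graph : Set₁ where
  field
    n     : ℕ
    Adj   : Fin n → Fin n → Set
    adj?  : ∀ u v → Dec (Adj u v)
    sym   : ∀ {u v} → Adj u v → Adj v u
    irrefl : ∀ {u} → ¬ Adj u u

module _ (G : Graph) where
  open Graph G

  Vertex : Set
  Vertex = Fin n

  data Walk : Vertex → Vertex → ℕ → Set where
    here : ∀ {u} → Walk u u 0
    step : ∀ {u w v k} → Adj u w → Walk w v k → Walk u v (suc k)

  Connected : Set
  Connected = ∀ u v → ∃ λ k → Walk u v k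

  Dist : Vertex → Vertex → ℕ → Set
  Dist u v k = Walk u v k × (∀ m → m < k → ¬ Walk u v m)

  Between : Vertex → Vertex → Vertex → Set
  Between a z b = ∃ λ dab → ∃ λ daz → ∃ λ dzb →
    Dist a b dab × Dist a z daz × Dist z b dzb × dab ≡ daz + dzb

  InLine : Vertex → Vertex → Vertex → Set
  InLine a b z = Between a z b ⊎ Between z a b ⊎ Between a b z

  SameLine : Vertex → Vertex → Vertex → Vertex → Set
  SameLine a b c d = ∀ z → InLine a b z ⇔ InLine c d z

  Universal : Vertex → Vertex → Set
  Universal a b = ∀ z → InLine a b z

  NoUniversalLine : Set
  NoUniversalLine = ∀ a b → a ≢ b → ¬ Universal a b

  GoodPair : Vertex → Vertex → Set
  GoodPair u v = Dist u v 2 × ∃ λ c → Adj u c × Adj c v × SameLine u c c v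

  InducedCopy : (k : ℕ) → (Fin k → Fin k → Set) → Set
  InducedCopy k H = Σ (Fin k → Vertex) λ f →
    Injective _≡_ _≡_ f × (∀ i j → Adj (f i) (f j) ⇔ H i j)

CycleAdj : (k : ℕ) → Fin k → Fin k → Set
CycleAdj k i j = suc (toℕ i) ≡ toℕ j ⊎ suc (toℕ j) ≡ toℕ i
               ⊎ (toℕ i ≡ 0 × suc (toℕ j) ≡ k) ⊎ (toℕ j ≡ 0 × suc (toℕ i) ≡ k)

HouseAdj : Fin 5 → Fin 5 → Set
HouseAdj i j = CycleAdj 5 i j ⊎ (toℕ i ≡ 1 × toℕ j ≡ 4) ⊎ (toℕ i ≡ 4 × toℕ j ≡ 1)

module _ (G : Graph) where
  HouseFree : Set
  HouseFree = ¬ InducedCopy G 5 HouseAdj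

  HoleFree : Set
  HoleFree = ∀ k → 5 Data.Nat.≤ k → ¬ InducedCopy G k (CycleAdj k)

module Submission where

-- Strategy.  (1) House- and hole-free graphs satisfy the triangle
-- condition: if u ~ v and d(u,w) = d(v,w) = m + 1, then u and v have a
-- common neighbour at distance m from w.  By strong induction on m: descend
-- greedily from u and from v towards w.  Either a vertex on a descent is
-- equidistant from u and v (apply the induction towards that vertex), or
-- the two descents form a ladder whose first rung closes an induced house
-- or hole, or which closes an odd hole through w.  (2) The line of an edge
-- pq is {z | d(p,z) ≠ d(q,z)}, so by (1) the line of an edge whose ends have
-- no common neighbour is universal.  (3) If the line of the edge uv equals
-- the line of a good pair, a parity argument shows that u and v have no
-- common neighbour; with (2) this contradicts the absence of universal lines.

open import Data.Nat using (ℕ; zero; suc; _+_; _∸_; _≤_; _<_; z≤n; s≤s; _≤?_) renaming (_≟_ to _≟ℕ_)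
open import Data.Nat.Properties
open import Data.Nat.Induction using (<-rec)
open import Data.Fin using (Fin; toℕ) renaming (zero to fzero; suc to fsuc)
open import Data.Fin.Properties using (toℕ-injective; toℕ<n; all?; any?) renaming (_≟_ to _≟ᶠ_)
open import Data.Product using (∃; _×_; _,_; proj₁; proj₂)
open import Data.Sum using (_⊎_; inj₁; inj₂; [_,_]′; swap) renaming (map to map-⊎)
open import Data.Empty using (⊥; ⊥-elim)
open import Data.Unit using (tt)
open import Function.Base using (_∘_)
open import Function.Bundles using (_⇔_; mk⇔; Equivalence)
open import Relation.Nullary using (¬_; Dec; yes; no)
open import Relation.Nullary.Decidable using (_×-dec_; _⊎-dec_; ¬?; toWitness; toWitnessFalse; True; False)
open import Relation.Binary.PropositionalEquality
open import Relation.Binary.Definitions using (tri<; tri≈; tri>)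

open import Defs

least : {A : ℕ → Set} → (∀ i → Dec (A i)) → ∀ B →
  (∃ λ i → i < B × A i × (∀ j → j < i → ¬ A j)) ⊎ (∀ i → i < B → ¬ A i)
least A? zero = inj₂ (λ i ())
least A? (suc B) with least A? B
... | inj₁ (i , i<B , a , below) = inj₁ (i , m<n⇒m<1+n i<B , a , below)
... | inj₂ none with A? B
...   | yes a = inj₁ (B , n<1+n B , a , none)
...   | no ¬a = inj₂ λ i i<1+B →
          [ none i , (λ { refl → ¬a }) ]′ (m≤n⇒m<n∨m≡n (≤-pred i<1+B))

Near : ℕ → ℕ → Set
Near a b = b ≡ a ⊎ b ≡ suc a ⊎ a ≡ suc b

near-by-bounds : ∀ a b → a ≤ suc b → b ≤ suc a → Near a b
near-by-bounds zero zero _ _ = inj₁ refl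
near-by-bounds zero (suc zero) _ _ = inj₂ (inj₁ refl)
near-by-bounds (suc zero) zero _ _ = inj₂ (inj₂ refl)
near-by-bounds zero (suc (suc b)) _ (s≤s ())
near-by-bounds (suc (suc a)) zero (s≤s ()) _
near-by-bounds (suc a) (suc b) (s≤s a≤1+b) (s≤s b≤1+a) with near-by-bounds a b a≤1+b b≤1+a
... | inj₁ e = inj₁ (cong suc e)
... | inj₂ (inj₁ e) = inj₂ (inj₁ (cong suc e))
... | inj₂ (inj₂ e) = inj₂ (inj₂ (cong suc e))

near-bounds : ∀ {a b} → Near a b → a ≤ suc b × b ≤ suc a
near-bounds {a} (inj₁ refl) = n≤1+n a , n≤1+n a
near-bounds {a} (inj₂ (inj₁ refl)) = m≤n⇒m≤1+n (n≤1+n a) , ≤-refl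
near-bounds {b = b} (inj₂ (inj₂ refl)) = ≤-refl , m≤n⇒m≤1+n (n≤1+n b)

Parity : ℕ → ℕ → Set
Parity a e = e ≡ a ⊎ e ≡ 2 + a ⊎ a ≡ 2 + e

-- Parity transfer along a path x – c – y: if the distances a, b, e of x, c, y
-- from some vertex satisfy |a−b|,|b−e| ≤ 1, and a = b exactly when b = e,
-- then a and e have the same parity.
parity-transfer : ∀ a b e → Near a b → Near b e → (a ≢ b → b ≢ e) → (b ≢ e → a ≢ b) → Parity a e
parity-transfer a .a .a (inj₁ refl) (inj₁ refl) _ _ = inj₁ refl
parity-transfer a .a .(suc a) (inj₁ refl) (inj₂ (inj₁ refl)) _ back = ⊥-elim (back (1+n≢n ∘ sym) refl)
parity-transfer .(suc e) .(suc e) e (inj₁ refl) (inj₂ (inj₂ refl)) _ back = ⊥-elim (back 1+n≢n refl)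
parity-transfer a .(suc a) .(suc a) (inj₂ (inj₁ refl)) (inj₁ refl) forth _ = ⊥-elim (forth (1+n≢n ∘ sym) refl)
parity-transfer a .(suc a) .(suc (suc a)) (inj₂ (inj₁ refl)) (inj₂ (inj₁ refl)) _ _ = inj₂ (inj₁ refl)
parity-transfer a .(suc a) .a (inj₂ (inj₁ refl)) (inj₂ (inj₂ refl)) _ _ = inj₁ refl
parity-transfer .(suc b) b .b (inj₂ (inj₂ refl)) (inj₁ refl) forth _ = ⊥-elim (forth 1+n≢n refl)
parity-transfer .(suc b) b .(suc b) (inj₂ (inj₂ refl)) (inj₂ (inj₁ refl)) _ _ = inj₁ refl
parity-transfer .(suc (suc e)) .(suc e) e (inj₂ (inj₂ refl)) (inj₂ (inj₂ refl)) _ _ = inj₂ (inj₂ refl)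

near-parity : ∀ {a b} → Near a b → Parity a b → a ≡ b
near-parity _ (inj₁ refl) = refl
near-parity ab (inj₂ (inj₁ refl)) = ⊥-elim (1+n≰n (proj₂ (near-bounds ab)))
near-parity ab (inj₂ (inj₂ refl)) = ⊥-elim (1+n≰n (proj₁ (near-bounds ab)))

apart-around : ∀ k a b → Near k a → Near k b → a ≢ k → b ≢ k → a ≢ b → ¬ Near a b
apart-around k .k b (inj₁ refl) _ a≢k _ _ _ = a≢k refl
apart-around k a .k _ (inj₁ refl) _ b≢k _ _ = b≢k refl
apart-around k .(suc k) .(suc k) (inj₂ (inj₁ refl)) (inj₂ (inj₁ refl)) _ _ a≢b _ = a≢b refl
apart-around .(suc b) .(suc (suc b)) b (inj₂ (inj₁ refl)) (inj₂ (inj₂ refl)) _ _ _ ab =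
  1+n≰n (proj₁ (near-bounds ab))
apart-around .(suc a) a .(suc (suc a)) (inj₂ (inj₂ refl)) (inj₂ (inj₁ refl)) _ _ _ ab =
  1+n≰n (proj₂ (near-bounds ab))
apart-around .(suc a) a .a (inj₂ (inj₂ refl)) (inj₂ (inj₂ refl)) _ _ a≢b _ = a≢b refl

squeeze : ∀ {k x} → k ≤ x → x ≤ suc k → x ≢ k → x ≡ suc k
squeeze k≤x x≤1+k x≢k with m≤n⇒m<n∨m≡n x≤1+k
... | inj₁ x<1+k = ⊥-elim (x≢k (≤-antisym (≤-pred x<1+k) k≤x))
... | inj₂ x≡1+k = x≡1+k

∸-consecutive : ∀ {r i j} → i ≤ r → j ≤ r → r ∸ j ≡ suc (r ∸ i) → i ≡ suc j
∸-consecutive {r} {zero} {j} _ _ e = ⊥-elim (1+n≰n (subst (_≤ r) e (m∸n≤m r j)))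
∸-consecutive {r} {suc i} i<r j≤r e =
  cong suc (∸-cancelˡ-≡ (<⇒≤ i<r) j≤r (trans (+-∸-assoc 1 i<r) (sym e)))

RingAdj : ℕ → ℕ → ℕ → Set
RingAdj K i j = suc i ≡ j ⊎ suc j ≡ i ⊎ (i ≡ 0 × suc j ≡ K) ⊎ (j ≡ 0 × suc i ≡ K)

ringAdj-sym : ∀ {K i j} → RingAdj K i j → RingAdj K j i
ringAdj-sym (inj₁ e) = inj₂ (inj₁ e)
ringAdj-sym (inj₂ (inj₁ e)) = inj₁ e
ringAdj-sym (inj₂ (inj₂ (inj₁ e))) = inj₂ (inj₂ (inj₂ e))
ringAdj-sym (inj₂ (inj₂ (inj₂ e))) = inj₂ (inj₂ (inj₁ e))

-- z lies on the line xy iff its distances a = d(x,z), b = d(y,z) satisfy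
-- LineEq (d(x,y)) a b: one of z, x, y lies between the other two.
LineEq : ℕ → ℕ → ℕ → Set
LineEq δ a b = δ ≡ a + b ⊎ b ≡ a + δ ⊎ a ≡ δ + b

lineEq-edge-elim : ∀ {a b} → LineEq 1 a b → a ≢ b
lineEq-edge-elim {zero} (inj₁ ()) refl
lineEq-edge-elim {suc a} (inj₁ e) refl = m+1+n≢0 a (sym (suc-injective e))
lineEq-edge-elim {a} (inj₂ (inj₁ e)) refl = m+1+n≢m a (sym e)
lineEq-edge-elim (inj₂ (inj₂ e)) refl = 1+n≢n (sym e)

lineEq-edge-intro : ∀ {a b} → Near a b → a ≢ b → LineEq 1 a b
lineEq-edge-intro (inj₁ refl) a≢b = ⊥-elim (a≢b refl)
lineEq-edge-intro {a} (inj₂ (inj₁ refl)) _ = inj₂ (inj₁ (+-comm 1 a))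
lineEq-edge-intro (inj₂ (inj₂ refl)) _ = inj₂ (inj₂ refl)

lineEq-two-equidistant : ∀ {a} → LineEq 2 a a → a ≡ 1
lineEq-two-equidistant {zero} (inj₁ ())
lineEq-two-equidistant {zero} (inj₂ (inj₁ ()))
lineEq-two-equidistant {zero} (inj₂ (inj₂ ()))
lineEq-two-equidistant {suc zero} _ = refl
lineEq-two-equidistant {suc (suc a)} (inj₁ e) = ⊥-elim (m+1+n≢0 a (sym (suc-injective (suc-injective e))))
lineEq-two-equidistant {suc (suc a)} (inj₂ (inj₁ e)) = ⊥-elim (m+1+n≢m (suc (suc a)) (sym e))
lineEq-two-equidistant {suc (suc a)} (inj₂ (inj₂ e)) = ⊥-elim (m≢1+n+m (suc (suc a)) {1} e)

lineEq-two-parity : ∀ {a b} → Parity a b → a ≢ b → LineEq 2 a b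
lineEq-two-parity (inj₁ refl) a≢b = ⊥-elim (a≢b refl)
lineEq-two-parity {a} (inj₂ (inj₁ refl)) _ = inj₂ (inj₁ (+-comm 2 a))
lineEq-two-parity (inj₂ (inj₂ refl)) _ = inj₂ (inj₂ refl)

module Distances (G : Graph) (connected : Connected G) where
  open Graph G renaming (sym to adj-sym)

  walk? : ∀ u v k → Dec (Walk G u v k)
  walk? u v zero with u ≟ᶠ v
  ... | yes refl = yes here
  ... | no u≢v = no λ { here → u≢v refl }
  walk? u v (suc k) with any? (λ w → adj? u w ×-dec walk? w v k)
  ... | yes (w , uw , walk) = yes (step uw walk)
  ... | no none = no λ { (step uw walk) → none (_ , uw , walk) }

  distance : ∀ u v → ∃ (Dist G u v)
  distance u v with connected u v
  ... | k , walk with least (walk? u v) (suc k)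
  ...   | inj₁ (i , _ , shortest , below) = i , shortest , below
  ...   | inj₂ none = ⊥-elim (none k ≤-refl walk)

  d : Vertex G → Vertex G → ℕ
  d u v = proj₁ (distance u v)

  d-dist : ∀ u v → Dist G u v (d u v)
  d-dist u v = proj₂ (distance u v)

  dist⇒d : ∀ {u v k} → Dist G u v k → d u v ≡ k
  dist⇒d {u} {v} {k} (walk , shortest) with <-cmp (d u v) k
  ... | tri< d<k _ _ = ⊥-elim (shortest (d u v) d<k (proj₁ (d-dist u v)))
  ... | tri≈ _ d≡k _ = d≡k
  ... | tri> _ _ k<d = ⊥-elim (proj₂ (d-dist u v) k k<d walk)

  d≤walk : ∀ {u v k} → Walk G u v k → d u v ≤ k
  d≤walk {u} {v} walk = ≮⇒≥ λ k<d → proj₂ (d-dist u v) _ k<d walk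

  _++_ : ∀ {u w v a b} → Walk G u w a → Walk G w v b → Walk G u v (a + b)
  here ++ q = q
  step e p ++ q = step e (p ++ q)

  snoc : ∀ {u v w k} → Walk G u v k → Adj v w → Walk G u w (suc k)
  snoc here e = step e here
  snoc (step e' p) e = step e' (snoc p e)

  reverse : ∀ {u v k} → Walk G u v k → Walk G v u k
  reverse here = here
  reverse (step e p) = snoc (reverse p) (adj-sym e)

  d-sym : ∀ u v → d u v ≡ d v u
  d-sym u v = ≤-antisym (d≤walk (reverse (proj₁ (d-dist v u)))) (d≤walk (reverse (proj₁ (d-dist u v))))

  d-triangle : ∀ u w v → d u v ≤ d u w + d w v
  d-triangle u w v = d≤walk (proj₁ (d-dist u w) ++ proj₁ (d-dist w v))

  d≡0⇒≡ : ∀ {u v} → d u v ≡ 0 → u ≡ v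
  d≡0⇒≡ {u} {v} eq with subst (Walk G u v) eq (proj₁ (d-dist u v))
  ... | here = refl

  d-refl : ∀ u → d u u ≡ 0
  d-refl u = n≤0⇒n≡0 (d≤walk here)

  d≡1⇒adj : ∀ {u v} → d u v ≡ 1 → Adj u v
  d≡1⇒adj {u} {v} eq with subst (Walk G u v) eq (proj₁ (d-dist u v))
  ... | step e here = e

  adj⇒d≡1 : ∀ {u v} → Adj u v → d u v ≡ 1
  adj⇒d≡1 {u} {v} e with d u v in eq | d≤walk (step e here)
  ... | zero | _ = ⊥-elim (irrefl (subst (Adj u) (sym (d≡0⇒≡ eq)) e))
  ... | suc zero | _ = refl
  ... | suc (suc _) | s≤s ()

  lipschitz : ∀ {p q} → Adj p q → ∀ z → d p z ≤ suc (d q z)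
  lipschitz {p} {q} e z = subst (λ δ → d p z ≤ δ + d q z) (adj⇒d≡1 e) (d-triangle p q z)

  near : ∀ {p q} → Adj p q → ∀ z → Near (d p z) (d q z)
  near e z = near-by-bounds _ _ (lipschitz e z) (lipschitz (adj-sym e) z)

  near′ : ∀ {p q} → Adj p q → ∀ z → Near (d z p) (d z q)
  near′ {p} {q} e z = subst₂ Near (d-sym p z) (d-sym q z) (near e z)

  step-toward : ∀ {u v k} → d u v ≡ suc k → ∃ λ w → Adj u w × d w v ≡ k
  step-toward {u} {v} {k} eq with subst (Walk G u v) eq (proj₁ (d-dist u v))
  ... | step {w = w} e walk =
    w , e , ≤-antisym (d≤walk walk) (≤-pred (subst (_≤ suc (d w v)) eq (lipschitz e v)))

  gap⇒¬adj : ∀ {x y} z {k} → d x z ≡ k → d y z ≡ 2 + k → ¬ Adj x y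
  gap⇒¬adj {x} {y} z dx dy xy = 1+n≰n (subst₂ _≤_ dy (cong suc dx) (lipschitz (adj-sym xy) z))

  level-gap : ∀ {v x w L i} → i ≤ L → d v w ≡ L → d x w ≡ L ∸ i → i ≤ d x v
  level-gap {v} {x} {w} {L} {i} i≤L dv dx = +-cancelʳ-≤ (L ∸ i) i (d x v) (begin
    i + (L ∸ i)       ≡⟨ m+[n∸m]≡n i≤L ⟩
    L                 ≡⟨ sym dv ⟩
    d v w             ≤⟨ d-triangle v x w ⟩
    d v x + d x w     ≡⟨ cong₂ _+_ (d-sym v x) dx ⟩
    d x v + (L ∸ i)   ∎)
    where open ≤-Reasoning

  between⇒ : ∀ {a z b} → Between G a z b → d a b ≡ d a z + d z b
  between⇒ (_ , _ , _ , ab , az , zb , eq)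
    rewrite dist⇒d ab | dist⇒d az | dist⇒d zb = eq

  ⇒between : ∀ {a z b} → d a b ≡ d a z + d z b → Between G a z b
  ⇒between {a} {z} {b} eq =
    d a b , d a z , d z b , d-dist a b , d-dist a z , d-dist z b , eq

  inLine⇒lineEq : ∀ {x y z} → InLine G x y z → LineEq (d x y) (d x z) (d y z)
  inLine⇒lineEq {x} {y} {z} (inj₁ xzy) =
    inj₁ (trans (between⇒ xzy) (cong (d x z +_) (d-sym z y)))
  inLine⇒lineEq {x} {y} {z} (inj₂ (inj₁ zxy)) =
    inj₂ (inj₁ (trans (d-sym y z) (trans (between⇒ zxy) (cong (_+ d x y) (d-sym z x)))))
  inLine⇒lineEq (inj₂ (inj₂ xyz)) = inj₂ (inj₂ (between⇒ xyz))

  lineEq⇒inLine : ∀ {x y z} → LineEq (d x y) (d x z) (d y z) → InLine G x y z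
  lineEq⇒inLine {x} {y} {z} (inj₁ eq) =
    inj₁ (⇒between (trans eq (cong (d x z +_) (d-sym y z))))
  lineEq⇒inLine {x} {y} {z} (inj₂ (inj₁ eq)) =
    inj₂ (inj₁ (⇒between (trans (d-sym z y) (trans eq (cong (_+ d x y) (d-sym x z))))))
  lineEq⇒inLine (inj₂ (inj₂ eq)) = inj₂ (inj₂ (⇒between eq))

Separated : ∀ {k} → (Fin k → Fin k → Set) → Fin k → Fin k → Set
Separated H i j = i ≡ j ⊎ H i j ⊎ ∃ λ l → (H i l × ¬ H j l) ⊎ (¬ H i l × H j l)

houseAdj? : ∀ i j → Dec (HouseAdj i j)
houseAdj? i j =
  ((suc (toℕ i) ≟ℕ toℕ j) ⊎-dec ((suc (toℕ j) ≟ℕ toℕ i) ⊎-dec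
   (((toℕ i ≟ℕ 0) ×-dec (suc (toℕ j) ≟ℕ 5)) ⊎-dec ((toℕ j ≟ℕ 0) ×-dec (suc (toℕ i) ≟ℕ 5)))))
  ⊎-dec (((toℕ i ≟ℕ 1) ×-dec (toℕ j ≟ℕ 4)) ⊎-dec ((toℕ i ≟ℕ 4) ×-dec (toℕ j ≟ℕ 1)))

house-separated : ∀ i j → Separated HouseAdj i j
house-separated = toWitness {a? = all? λ i → all? λ j → separated? i j} tt
  where
    separated? : ∀ i j → Dec (Separated HouseAdj i j)
    separated? i j = (i ≟ᶠ j) ⊎-dec (houseAdj? i j ⊎-dec any? λ l →
      (houseAdj? i l ×-dec ¬? (houseAdj? j l)) ⊎-dec (¬? (houseAdj? i l) ×-dec houseAdj? j l))

module InducedSubgraphs (G : Graph) where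
  open Graph G renaming (sym to adj-sym)

  record InducedPath (P : ℕ → Vertex G) (r : ℕ) : Set where
    field
      edge      : ∀ i → i < r → Adj (P i) (P (suc i))
      chordless : ∀ i j → i ≤ r → j ≤ r → Adj (P i) (P j) → j ≡ suc i ⊎ i ≡ suc j
      distinct  : ∀ i j → i ≤ r → j ≤ r → P i ≡ P j → i ≡ j

  truncate : ∀ {P r r'} → r' ≤ r → InducedPath P r → InducedPath P r'
  truncate r'≤r π = record
    { edge      = λ i i<r' → edge i (≤-trans i<r' r'≤r)
    ; chordless = λ i j i≤r' j≤r' → chordless i j (≤-trans i≤r' r'≤r) (≤-trans j≤r' r'≤r)
    ; distinct  = λ i j i≤r' j≤r' → distinct i j (≤-trans i≤r' r'≤r) (≤-trans j≤r' r'≤r)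
    }
    where open InducedPath π

  backwards : ∀ {P r} → InducedPath P r → InducedPath (λ i → P (r ∸ i)) r
  backwards {P} {r} π = record
    { edge      = reversedEdge
    ; chordless = λ i j i≤r j≤r a →
        swap (map-⊎ (∸-consecutive i≤r j≤r) (∸-consecutive j≤r i≤r)
          (chordless (r ∸ i) (r ∸ j) (m∸n≤m r i) (m∸n≤m r j) a))
    ; distinct  = λ i j i≤r j≤r eq →
        ∸-cancelˡ-≡ i≤r j≤r (distinct (r ∸ i) (r ∸ j) (m∸n≤m r i) (m∸n≤m r j) eq)
    }
    where
      open InducedPath π
      reversedEdge : ∀ i → i < r → Adj (P (r ∸ i)) (P (r ∸ suc i))
      reversedEdge i i<r = subst (λ k → Adj (P k) (P (r ∸ suc i))) (sym r∸i)
        (adj-sym (edge (r ∸ suc i) (subst (_≤ r) r∸i (m∸n≤m r i))))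
        where
          r∸i : r ∸ i ≡ suc (r ∸ suc i)
          r∸i = +-∸-assoc 1 i<r

  record InducedCycle (C : ℕ → Vertex G) (k : ℕ) : Set where
    field
      edge      : ∀ i → i < k → Adj (C i) (C (suc i))
      closing   : Adj (C k) (C 0)
      chordless : ∀ i j → i ≤ k → j ≤ k → Adj (C i) (C j) → RingAdj (suc k) i j
      distinct  : ∀ i j → i ≤ k → j ≤ k → C i ≡ C j → i ≡ j

  inducedCycle⇒copy : ∀ {C k} → InducedCycle C k → InducedCopy G (suc k) (CycleAdj (suc k))
  inducedCycle⇒copy {C} {k} γ =
    C ∘ toℕ ,
    (λ eq → toℕ-injective (distinct _ _ (bound _) (bound _) eq)) ,
    λ i j → mk⇔ (chordless _ _ (bound i) (bound j)) (ringEdge _ _ (bound i) (bound j))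
    where
      open InducedCycle γ
      bound : (i : Fin (suc k)) → toℕ i ≤ k
      bound i = ≤-pred (toℕ<n i)
      ringEdge : ∀ i j → i ≤ k → j ≤ k → RingAdj (suc k) i j → Adj (C i) (C j)
      ringEdge i _ _ j≤k (inj₁ refl) = edge i j≤k
      ringEdge _ j i≤k _ (inj₂ (inj₁ refl)) = adj-sym (edge j i≤k)
      ringEdge _ _ _ _ (inj₂ (inj₂ (inj₁ (refl , refl)))) = adj-sym closing
      ringEdge _ _ _ _ (inj₂ (inj₂ (inj₂ (refl , refl)))) = closing

  module LadderCycle {P Q : ℕ → Vertex G} {r s : ℕ}
    (π : InducedPath P r) (κ : InducedPath Q s)
    (bottom : Adj (P 0) (Q 0)) (top : Adj (P r) (Q s))
    (cross : ∀ i j → i ≤ r → j ≤ s → Adj (P i) (Q j) → (i ≡ 0 × j ≡ 0) ⊎ (i ≡ r × j ≡ s))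
    (disjoint : ∀ i j → i ≤ r → j ≤ s → P i ≢ Q j) where

    module π = InducedPath π

    Q′ : ℕ → Vertex G
    Q′ j = Q (s ∸ j)
    module κ′ = InducedPath (backwards κ)

    C : ℕ → Vertex G
    C n with n ≤? r
    ... | yes _ = P n
    ... | no _  = Q′ (n ∸ suc r)

    C-onP : ∀ {i} → i ≤ r → C i ≡ P i
    C-onP {i} i≤r with i ≤? r
    ... | yes _ = refl
    ... | no i≰r = ⊥-elim (i≰r i≤r)

    C-onQ : ∀ b → C (suc (r + b)) ≡ Q′ b
    C-onQ b with suc (r + b) ≤? r
    ... | yes r+b<r = ⊥-elim (1+n≰n (≤-trans (s≤s (m≤m+n r b)) r+b<r))
    ... | no _ = cong Q′ (m+n∸m≡n r b)

    data Position : ℕ → Set where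
      onP : ∀ {i} → i ≤ r → Position i
      onQ : ∀ {b} → b ≤ s → Position (suc (r + b))

    position : ∀ n → n ≤ suc (r + s) → Position n
    position n n≤ with n ≤? r
    ... | yes n≤r = onP n≤r
    ... | no n≰r = subst Position (m+[n∸m]≡n (≰⇒> n≰r)) (onQ (m≤n+o⇒m∸n≤o n (suc r) n≤))

    cross′ : ∀ i b → i ≤ r → b ≤ s → Adj (P i) (Q′ b) → (i ≡ 0 × b ≡ s) ⊎ (i ≡ r × b ≡ 0)
    cross′ i b i≤r b≤s a with cross i (s ∸ b) i≤r (m∸n≤m s b) a
    ... | inj₁ (i≡0 , s∸b≡0) = inj₁ (i≡0 , ∸-cancelˡ-≡ b≤s ≤-refl (trans s∸b≡0 (sym (n∸n≡0 s))))
    ... | inj₂ (i≡r , s∸b≡s) = inj₂ (i≡r , ∸-cancelˡ-≡ b≤s z≤n s∸b≡s)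

    edgeAt : ∀ {n} → Position n → n < suc (r + s) → Adj (C n) (C (suc n))
    edgeAt (onP {i} i≤r) _ with m≤n⇒m<n∨m≡n i≤r
    ... | inj₁ i<r = subst₂ Adj (sym (C-onP i≤r)) (sym (C-onP i<r)) (π.edge i i<r)
    ... | inj₂ refl = subst₂ Adj (sym (C-onP ≤-refl))
                        (sym (trans (cong (C ∘ suc) (sym (+-identityʳ r))) (C-onQ 0))) top
    edgeAt (onQ {b} b≤s) n< = subst₂ Adj (sym (C-onQ b))
      (sym (trans (cong (C ∘ suc) (sym (+-suc r b))) (C-onQ (suc b))))
      (κ′.edge b (+-cancelˡ-≤ r (suc b) s (subst (_≤ r + s) (sym (+-suc r b)) (≤-pred n<))))

    closing : Adj (C (suc (r + s))) (C 0)
    closing = subst₂ Adj (sym (trans (C-onQ s) (cong Q (n∸n≡0 s)))) (sym (C-onP z≤n)) (adj-sym bottom)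

    chordlessAt : ∀ {i j} → Position i → Position j → Adj (C i) (C j) →
      RingAdj (suc (suc (r + s))) i j
    chordlessAt (onP {i} i≤r) (onP {j} j≤r) a =
      [ inj₁ ∘ sym , inj₂ ∘ inj₁ ∘ sym ]′ (π.chordless i j i≤r j≤r (subst₂ Adj (C-onP i≤r) (C-onP j≤r) a))
    chordlessAt (onP {i} i≤r) (onQ {b} b≤s) a with cross′ i b i≤r b≤s (subst₂ Adj (C-onP i≤r) (C-onQ b) a)
    ... | inj₁ (refl , refl) = inj₂ (inj₂ (inj₁ (refl , refl)))
    ... | inj₂ (refl , refl) = inj₁ (cong suc (sym (+-identityʳ r)))
    chordlessAt p@(onQ _) q@(onP _) a = ringAdj-sym (chordlessAt q p (adj-sym a))
    chordlessAt (onQ {b} b≤s) (onQ {b′} b′≤s) a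
      with κ′.chordless b b′ b≤s b′≤s (subst₂ Adj (C-onQ b) (C-onQ b′) a)
    ... | inj₁ refl = inj₁ (cong suc (sym (+-suc r b)))
    ... | inj₂ refl = inj₂ (inj₁ (cong suc (sym (+-suc r b′))))

    distinctAt : ∀ {i j} → Position i → Position j → C i ≡ C j → i ≡ j
    distinctAt (onP {i} i≤r) (onP {j} j≤r) eq =
      π.distinct i j i≤r j≤r (trans (sym (C-onP i≤r)) (trans eq (C-onP j≤r)))
    distinctAt (onP {i} i≤r) (onQ {b} _) eq =
      ⊥-elim (disjoint i (s ∸ b) i≤r (m∸n≤m s b) (trans (sym (C-onP i≤r)) (trans eq (C-onQ b))))
    distinctAt p@(onQ _) q@(onP _) eq = sym (distinctAt q p (sym eq))
    distinctAt (onQ {b} b≤s) (onQ {b′} b′≤s) eq =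
      cong (suc ∘ (r +_)) (κ′.distinct b b′ b≤s b′≤s (trans (sym (C-onQ b)) (trans eq (C-onQ b′))))

    cycle : InducedCycle C (suc (r + s))
    cycle = record
      { edge      = λ n n< → edgeAt (position n (<⇒≤ n<)) n<
      ; closing   = closing
      ; chordless = λ i j i≤ j≤ → chordlessAt (position i i≤) (position j j≤)
      ; distinct  = λ i j i≤ j≤ → distinctAt (position i i≤) (position j j≤)
      }

  ladder-cycle : ∀ {P Q r s} → InducedPath P r → InducedPath Q s →
    Adj (P 0) (Q 0) → Adj (P r) (Q s) →
    (∀ i j → i ≤ r → j ≤ s → Adj (P i) (Q j) → (i ≡ 0 × j ≡ 0) ⊎ (i ≡ r × j ≡ s)) →
    (∀ i j → i ≤ r → j ≤ s → P i ≢ Q j) →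
    InducedCopy G (suc (suc (r + s))) (CycleAdj (suc (suc (r + s))))
  ladder-cycle π κ bottom top cross disjoint =
    inducedCycle⇒copy (LadderCycle.cycle π κ bottom top cross disjoint)

  -- A map preserving and reflecting adjacency with respect to a pattern in
  -- which any two vertices are separated is injective: a collapsed pair
  -- would either be a loop or have the same neighbours.
  separated⇒injective : ∀ {k} (H : Fin k → Fin k → Set) → (∀ i j → Separated H i j) →
    (f : Fin k → Vertex G) → (∀ i j → Adj (f i) (f j) ⇔ H i j) → ∀ {i j} → f i ≡ f j → i ≡ j
  separated⇒injective H separated f adj {i} {j} fi≡fj with separated i j
  ... | inj₁ i≡j = i≡j
  ... | inj₂ (inj₁ hij) = ⊥-elim (irrefl (subst (Adj (f i)) (sym fi≡fj) (Equivalence.from (adj i j) hij)))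
  ... | inj₂ (inj₂ (l , inj₁ (hil , ¬hjl))) =
    ⊥-elim (¬hjl (Equivalence.to (adj j l) (subst (λ x → Adj x (f l)) fi≡fj (Equivalence.from (adj i l) hil))))
  ... | inj₂ (inj₂ (l , inj₂ (¬hil , hjl))) =
    ⊥-elim (¬hil (Equivalence.to (adj i l) (subst (λ x → Adj x (f l)) (sym fi≡fj) (Equivalence.from (adj j l) hjl))))

  induced-house : ∀ a₀ a₁ a₂ a₃ a₄ →
    Adj a₀ a₁ → Adj a₁ a₂ → Adj a₂ a₃ → Adj a₃ a₄ → Adj a₄ a₀ → Adj a₁ a₄ →
    ¬ Adj a₀ a₂ → ¬ Adj a₀ a₃ → ¬ Adj a₁ a₃ → ¬ Adj a₂ a₄ →
    InducedCopy G 5 HouseAdj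
  induced-house a₀ a₁ a₂ a₃ a₄ e01 e12 e23 e34 e40 e14 n02 n03 n13 n24 =
    f , separated⇒injective HouseAdj house-separated f table , table
    where
      f : Fin 5 → Vertex G
      f fzero = a₀
      f (fsuc fzero) = a₁
      f (fsuc (fsuc fzero)) = a₂
      f (fsuc (fsuc (fsuc fzero))) = a₃
      f (fsuc (fsuc (fsuc (fsuc fzero)))) = a₄

      E : ∀ {i j} → Adj (f i) (f j) → True (houseAdj? i j) → Adj (f i) (f j) ⇔ HouseAdj i j
      E a h = mk⇔ (λ _ → toWitness h) (λ _ → a)

      N : ∀ {i j} → ¬ Adj (f i) (f j) → False (houseAdj? i j) → Adj (f i) (f j) ⇔ HouseAdj i j
      N ¬a ¬h = mk⇔ (⊥-elim ∘ ¬a) (⊥-elim ∘ toWitnessFalse ¬h)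

      N′ : ∀ {i j} → ¬ Adj (f j) (f i) → False (houseAdj? i j) → Adj (f i) (f j) ⇔ HouseAdj i j
      N′ ¬a = N (¬a ∘ adj-sym)

      table : ∀ i j → Adj (f i) (f j) ⇔ HouseAdj i j
      table fzero fzero = N irrefl tt
      table fzero (fsuc fzero) = E e01 tt
      table fzero (fsuc (fsuc fzero)) = N n02 tt
      table fzero (fsuc (fsuc (fsuc fzero))) = N n03 tt
      table fzero (fsuc (fsuc (fsuc (fsuc fzero)))) = E (adj-sym e40) tt
      table (fsuc fzero) fzero = E (adj-sym e01) tt
      table (fsuc fzero) (fsuc fzero) = N irrefl tt
      table (fsuc fzero) (fsuc (fsuc fzero)) = E e12 tt
      table (fsuc fzero) (fsuc (fsuc (fsuc fzero))) = N n13 tt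
      table (fsuc fzero) (fsuc (fsuc (fsuc (fsuc fzero)))) = E e14 tt
      table (fsuc (fsuc fzero)) fzero = N′ n02 tt
      table (fsuc (fsuc fzero)) (fsuc fzero) = E (adj-sym e12) tt
      table (fsuc (fsuc fzero)) (fsuc (fsuc fzero)) = N irrefl tt
      table (fsuc (fsuc fzero)) (fsuc (fsuc (fsuc fzero))) = E e23 tt
      table (fsuc (fsuc fzero)) (fsuc (fsuc (fsuc (fsuc fzero)))) = N n24 tt
      table (fsuc (fsuc (fsuc fzero))) fzero = N′ n03 tt
      table (fsuc (fsuc (fsuc fzero))) (fsuc fzero) = N′ n13 tt
      table (fsuc (fsuc (fsuc fzero))) (fsuc (fsuc fzero)) = E (adj-sym e23) tt
      table (fsuc (fsuc (fsuc fzero))) (fsuc (fsuc (fsuc fzero))) = N irrefl tt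
      table (fsuc (fsuc (fsuc fzero))) (fsuc (fsuc (fsuc (fsuc fzero)))) = E e34 tt
      table (fsuc (fsuc (fsuc (fsuc fzero)))) fzero = E e40 tt
      table (fsuc (fsuc (fsuc (fsuc fzero)))) (fsuc fzero) = E (adj-sym e14) tt
      table (fsuc (fsuc (fsuc (fsuc fzero)))) (fsuc (fsuc fzero)) = N′ n24 tt
      table (fsuc (fsuc (fsuc (fsuc fzero)))) (fsuc (fsuc (fsuc fzero))) = E (adj-sym e34) tt
      table (fsuc (fsuc (fsuc (fsuc fzero)))) (fsuc (fsuc (fsuc (fsuc fzero)))) = N irrefl tt

module Geodesics (G : Graph) (connected : Connected G) where
  open Graph G renaming (sym to adj-sym)
  open Distances G connected
  open InducedSubgraphs G

  geodesic⇒induced : ∀ (P : ℕ → Vertex G) r → (∀ i → i < r → Adj (P i) (P (suc i))) →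
    (∀ i → i ≤ r → d (P i) (P 0) ≡ i) → InducedPath P r
  geodesic⇒induced P r edge fromStart = record
    { edge = edge
    ; chordless = chordless
    ; distinct = λ i j i≤r j≤r eq →
        trans (sym (fromStart i i≤r)) (trans (cong (λ x → d x (P 0)) eq) (fromStart j j≤r))
    }
    where
      chordless : ∀ i j → i ≤ r → j ≤ r → Adj (P i) (P j) → j ≡ suc i ⊎ i ≡ suc j
      chordless i j i≤r j≤r a
        with subst₂ Near (fromStart i i≤r) (fromStart j j≤r) (near a (P 0))
      ... | inj₁ refl = ⊥-elim (irrefl a)
      ... | inj₂ consecutive = consecutive

  module Descent (w : Vertex G) where
    descent : ∀ L s → d s w ≡ L → ℕ → Vertex G
    descent L s e zero = s
    descent zero s e (suc i) = s
    descent (suc L) s e (suc i) = descent L (proj₁ (step-toward e)) (proj₂ (proj₂ (step-toward e))) i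

    descent-level : ∀ L s e i → i ≤ L → d (descent L s e i) w ≡ L ∸ i
    descent-level L s e zero _ = e
    descent-level (suc L) s e (suc i) (s≤s i≤L) = descent-level L _ _ i i≤L

    descent-edge : ∀ L s e i → i < L → Adj (descent L s e i) (descent L s e (suc i))
    descent-edge (suc L) s e zero _ = proj₁ (proj₂ (step-toward e))
    descent-edge (suc L) s e (suc i) (s≤s i<L) = descent-edge L _ _ i i<L

    descent-walk : ∀ L s e i → i ≤ L → Walk G s (descent L s e i) i
    descent-walk L s e zero _ = here
    descent-walk (suc L) s e (suc i) (s≤s i≤L) =
      step (proj₁ (proj₂ (step-toward e))) (descent-walk L _ _ i i≤L)

    descent-fromStart : ∀ L s e i → i ≤ L → d (descent L s e i) s ≡ i
    descent-fromStart L s e i i≤L = ≤-antisym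
      (subst (_≤ i) (d-sym s _) (d≤walk (descent-walk L s e i i≤L)))
      (level-gap i≤L e (descent-level L s e i i≤L))

    descent-induced : ∀ L s e → InducedPath (descent L s e) L
    descent-induced L s e = geodesic⇒induced _ L (descent-edge L s e) (descent-fromStart L s e)

module TriangleCondition (G : Graph) (connected : Connected G)
                         (houseFree : HouseFree G) (holeFree : HoleFree G) where
  open Graph G renaming (sym to adj-sym)
  open Distances G connected
  open InducedSubgraphs G
  open Geodesics G connected

  CommonNeighbourAt : Vertex G → ℕ → Vertex G → Vertex G → Set
  CommonNeighbourAt w m u v = ∃ λ t → Adj u t × Adj v t × d t w ≡ m

  TriangleAt : ℕ → Set
  TriangleAt m = ∀ w u v → Adj u v → d u w ≡ suc m → d v w ≡ suc m → CommonNeighbourAt w m u v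

  module Step (m : ℕ) (smaller : ∀ {k} → k < suc m → TriangleAt k) (w : Vertex G) where
    open Descent w

    L : ℕ
    L = suc (suc m)

    -- A vertex x at distance i + 1 from both ends of an edge ab of level L,
    -- and at level L − (i + 1) itself, gives by the triangle condition at
    -- level i towards x a common neighbour of a and b at level m + 1.
    shortcut : ∀ {a b} → Adj a b → d a w ≡ L → ∀ i → i < suc m → ∀ x →
      d x a ≡ suc i → d x b ≡ suc i → d x w ≡ suc m ∸ i → CommonNeighbourAt w (suc m) a b
    shortcut {a} {b} ab da i i<1+m x xa xb xw
      with smaller i<1+m x a b ab (trans (d-sym a x) xa) (trans (d-sym b x) xb)
    ... | t , at , bt , tx = t , at , bt , ≤-antisym upper lower
      where
        upper : d t w ≤ suc m
        upper = begin
          d t w            ≤⟨ d-triangle t x w ⟩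
          d t x + d x w    ≡⟨ cong₂ _+_ tx xw ⟩
          i + (suc m ∸ i)  ≡⟨ m+[n∸m]≡n (<⇒≤ i<1+m) ⟩
          suc m            ∎
          where open ≤-Reasoning
        lower : suc m ≤ d t w
        lower = ≤-pred (subst (_≤ suc (d t w)) da (lipschitz at w))

    offset-or-shortcut : ∀ {a b} → Adj a b → (da : d a w ≡ L) → d b w ≡ L →
      CommonNeighbourAt w (suc m) a b ⊎ (∀ i → i ≤ suc m → d (descent L a da i) b ≡ suc i)
    offset-or-shortcut {a} {b} ab da db
      with anyUpTo? (λ i → d (descent L a da (suc i)) b ≟ℕ suc i) (suc m)
    ... | yes (i , i<1+m , equidistant) = inj₁ (shortcut ab da i i<1+m _
          (descent-fromStart L a da (suc i) (m≤n⇒m≤1+n i<1+m)) equidistant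
          (descent-level L a da (suc i) (m≤n⇒m≤1+n i<1+m)))
    ... | no no-shortcut = inj₂ offset
      where
        -- d(x, b) for the (i+1)-th vertex x lies between i + 1 (x is at
        -- level L − (i+1)) and i + 2 (x is at distance i + 1 from a ~ b),
        -- and it is not i + 1 since x is no shortcut.
        offset : ∀ i → i ≤ suc m → d (descent L a da i) b ≡ suc i
        offset zero _ = adj⇒d≡1 ab
        offset (suc i) i<1+m = squeeze
          (level-gap 1+i≤L db (descent-level L a da (suc i) 1+i≤L))
          (subst₂ _≤_ (d-sym b x) (cong suc (trans (d-sym a x) (descent-fromStart L a da (suc i) 1+i≤L)))
            (lipschitz (adj-sym ab) x))
          (λ eq → no-shortcut (i , i<1+m , eq))
          where
            1+i≤L : suc i ≤ L
            1+i≤L = m≤n⇒m≤1+n i<1+m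
            x : Vertex G
            x = descent L a da (suc i)

    -- Without shortcuts on either side, the descents P from u and Q from v
    -- form a ladder: P(i) is closer to u, Q(i) closer to v.  Its first rung
    -- P(ρ)Q(ρ) closes a house (ρ = 1) or a hole (ρ ≥ 2); with no rung at
    -- all, P meets w and P, Q close an odd hole.
    module Ladder {u v} (uv : Adj u v) (du : d u w ≡ L) (dv : d v w ≡ L)
      (Pv : ∀ i → i ≤ suc m → d (descent L u du i) v ≡ suc i)
      (Qu : ∀ i → i ≤ suc m → d (descent L v dv i) u ≡ suc i) where

      P Q : ℕ → Vertex G
      P = descent L u du
      Q = descent L v dv

      Pu : ∀ i → i ≤ suc m → d (P i) u ≡ i
      Pu i i≤1+m = descent-fromStart L u du i (m≤n⇒m≤1+n i≤1+m)

      Qv : ∀ i → i ≤ suc m → d (Q i) v ≡ i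
      Qv i i≤1+m = descent-fromStart L v dv i (m≤n⇒m≤1+n i≤1+m)

      rung-level : ∀ i j → i ≤ suc m → j ≤ suc m → Adj (P i) (Q j) → i ≡ j
      rung-level i j i≤ j≤ a = ≤-antisym
        (≤-pred (subst₂ _≤_ (Pv i i≤) (cong suc (Qv j j≤)) (lipschitz a v)))
        (≤-pred (subst₂ _≤_ (Qu j j≤) (cong suc (Pu i i≤)) (lipschitz (adj-sym a) u)))

      -- The two rails share no vertex: P(i) is closer to u, Q(j) closer to v.
      rails-disjoint : ∀ i j → i ≤ suc m → j ≤ suc m → P i ≢ Q j
      rails-disjoint i j i≤ j≤ eq = m≢1+n+m i {1} (begin
        i          ≡⟨ sym (Pu i i≤) ⟩
        d (P i) u  ≡⟨ cong (λ x → d x u) eq ⟩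
        d (Q j) u  ≡⟨ Qu j j≤ ⟩
        suc j      ≡⟨ cong suc (sym (Qv j j≤)) ⟩
        suc (d (Q j) v) ≡⟨ cong (λ x → suc (d x v)) (sym eq) ⟩
        suc (d (P i) v) ≡⟨ cong suc (Pv i i≤) ⟩
        suc (suc i) ∎)
        where open ≡-Reasoning

      ends-only : ∀ ρ → ρ ≤ suc m → (∀ j → suc j < ρ → ¬ Adj (P (suc j)) (Q (suc j))) →
        ∀ i j → i ≤ ρ → j ≤ ρ → Adj (P i) (Q j) → (i ≡ 0 × j ≡ 0) ⊎ (i ≡ ρ × j ≡ ρ)
      ends-only ρ ρ≤ no-rung i j i≤ρ j≤ρ a with rung-level i j (≤-trans i≤ρ ρ≤) (≤-trans j≤ρ ρ≤) a
      ends-only ρ ρ≤ no-rung zero .zero _ _ _ | refl = inj₁ (refl , refl)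
      ends-only ρ ρ≤ no-rung (suc k) .(suc k) 1+k≤ρ _ a | refl with m≤n⇒m<n∨m≡n 1+k≤ρ
      ... | inj₁ 1+k<ρ = ⊥-elim (no-rung k 1+k<ρ a)
      ... | inj₂ refl = inj₂ (refl , refl)

      P-induced : InducedPath P L
      P-induced = descent-induced L u du

      Q-induced : InducedPath Q L
      Q-induced = descent-induced L v dv

      -- Rung at level 1: with a common neighbour t of P(1), Q(1) one level
      -- lower, t P(1) u v Q(1) is an induced house.
      no-house : ¬ Adj (P 1) (Q 1)
      no-house rung with smaller (n<1+n m) w (P 1) (Q 1) rung
                           (descent-level L u du 1 (s≤s z≤n)) (descent-level L v dv 1 (s≤s z≤n))
      ... | t , P₁t , Q₁t , tw = houseFree (induced-house t (P 1) u v (Q 1)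
            (adj-sym P₁t) (adj-sym (descent-edge L u du 0 (s≤s z≤n))) uv
            (descent-edge L v dv 0 (s≤s z≤n)) Q₁t rung
            (gap⇒¬adj w tw du) (gap⇒¬adj w tw dv)
            (gap⇒¬adj v (d-refl v) (Pv 1 (s≤s z≤n)) ∘ adj-sym)
            (gap⇒¬adj u (d-refl u) (Qu 1 (s≤s z≤n))))

      -- First rung at level ρ = i + 2: the ladder up to ρ is a hole of
      -- length 2ρ + 2.
      no-even-hole : ∀ i → suc (suc i) ≤ suc m → Adj (P (suc (suc i))) (Q (suc (suc i))) →
        (∀ j → j < suc i → ¬ Adj (P (suc j)) (Q (suc j))) → ⊥
      no-even-hole i ρ≤1+m rung below = holeFree _ five
        (ladder-cycle (truncate ρ≤L P-induced) (truncate ρ≤L Q-induced) uv rung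
          (ends-only ρ ρ≤1+m (λ j 1+j<ρ → below j (≤-pred 1+j<ρ)))
          (λ i′ j i′≤ρ j≤ρ → rails-disjoint i′ j (≤-trans i′≤ρ ρ≤1+m) (≤-trans j≤ρ ρ≤1+m)))
        where
          ρ : ℕ
          ρ = suc (suc i)
          ρ≤L : ρ ≤ L
          ρ≤L = m≤n⇒m≤1+n ρ≤1+m
          five : 5 ≤ suc (suc (ρ + ρ))
          five = s≤s (s≤s (s≤s (s≤s (≤-trans (s≤s z≤n) (m≤n+m ρ i)))))

      -- No rung at all: P reaches w, which is adjacent to Q(m + 1), and
      -- P(0..L), Q(0..m+1) close a hole of odd length 2m + 5.
      no-odd-hole : (∀ j → j < suc m → ¬ Adj (P (suc j)) (Q (suc j))) → ⊥
      no-odd-hole no-rung = holeFree _ five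
        (ladder-cycle P-induced (truncate (n≤1+n (suc m)) Q-induced) uv top cross disjoint)
        where
          five : 5 ≤ suc (suc (L + suc m))
          five = s≤s (s≤s (s≤s (s≤s (≤-trans (s≤s z≤n) (m≤n+m (suc m) m)))))
          Pₗ≡w : P L ≡ w
          Pₗ≡w = d≡0⇒≡ (trans (descent-level L u du L ≤-refl) (n∸n≡0 L))
          Pₗv : d (P L) v ≡ L
          Pₗv = trans (cong (λ x → d x v) Pₗ≡w) (trans (d-sym w v) dv)
          top : Adj (P L) (Q (suc m))
          top = subst (λ x → Adj x (Q (suc m))) (sym Pₗ≡w) (adj-sym (d≡1⇒adj
            (trans (descent-level L v dv (suc m) (n≤1+n (suc m))) (m+n∸n≡m 1 m))))
          -- A cross edge below P(L) is a rung, hence at level 0; one at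
          -- P(L) = w (at distance L from v) reaches Q(m + 1).
          cross : ∀ i j → i ≤ L → j ≤ suc m → Adj (P i) (Q j) → (i ≡ 0 × j ≡ 0) ⊎ (i ≡ L × j ≡ suc m)
          cross i j i≤L j≤1+m a with m≤n⇒m<n∨m≡n i≤L
          ... | inj₂ refl = inj₂ (refl , ≤-antisym j≤1+m
                  (≤-pred (subst₂ _≤_ Pₗv (cong suc (Qv j j≤1+m)) (lipschitz a v))))
          ... | inj₁ i<L with ends-only (suc m) ≤-refl (λ k 1+k<1+m → no-rung k (m≤n⇒m≤1+n (≤-pred 1+k<1+m)))
                                i j (≤-pred i<L) j≤1+m a
          ...   | inj₁ ends = inj₁ ends
          ...   | inj₂ (refl , refl) = ⊥-elim (no-rung m ≤-refl a)
          -- P(L) = w is at distance L from v, farther than Q(0..m+1).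
          disjoint : ∀ i j → i ≤ L → j ≤ suc m → P i ≢ Q j
          disjoint i j i≤L j≤1+m eq with m≤n⇒m<n∨m≡n i≤L
          ... | inj₁ i<L = rails-disjoint i j (≤-pred i<L) j≤1+m eq
          ... | inj₂ refl = 1+n≰n (subst (_≤ suc m)
                  (trans (sym (Qv j j≤1+m)) (trans (cong (λ x → d x v) (sym eq)) Pₗv)) j≤1+m)

      impossible : ⊥
      impossible with least (λ i → adj? (P (suc i)) (Q (suc i))) (suc m)
      ... | inj₁ (zero , _ , rung , _) = no-house rung
      ... | inj₁ (suc i , ρ≤1+m , rung , below) = no-even-hole i ρ≤1+m rung below
      ... | inj₂ no-rung = no-odd-hole no-rung

    common-neighbour : ∀ {u v} → Adj u v → d u w ≡ L → d v w ≡ L → CommonNeighbourAt w (suc m) u v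
    common-neighbour uv du dv with offset-or-shortcut uv du dv
    ... | inj₁ found = found
    ... | inj₂ Pv with offset-or-shortcut (adj-sym uv) dv du
    ...   | inj₁ (t , vt , ut , tw) = t , ut , vt , tw
    ...   | inj₂ Qu = ⊥-elim (Ladder.impossible uv du dv Pv Qu)

  triangle : ∀ m → TriangleAt m
  triangle = <-rec TriangleAt inductive-step
    where
      inductive-step : ∀ m → (∀ {k} → k < m → TriangleAt k) → TriangleAt m
      inductive-step zero _ w u v uv du dv = w , d≡1⇒adj du , d≡1⇒adj dv , d-refl w
      inductive-step (suc m) smaller w u v uv du dv = Step.common-neighbour m smaller w uv du dv

  equidistant⇒common-neighbour : ∀ {u v z} → Adj u v → d u z ≡ d v z → ∃ λ t → Adj u t × Adj v t
  equidistant⇒common-neighbour {u} {v} {z} uv eq = at-level (d u z) refl (sym eq)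
    where
      at-level : ∀ k → d u z ≡ k → d v z ≡ k → ∃ λ t → Adj u t × Adj v t
      at-level zero du dv = ⊥-elim (irrefl (subst (Adj u) (trans (d≡0⇒≡ dv) (sym (d≡0⇒≡ du))) uv))
      at-level (suc k) du dv with triangle k z u v uv du dv
      ... | t , ut , vt , _ = t , ut , vt

module Lines (G : Graph) (connected : Connected G) where
  open Graph G renaming (sym to adj-sym)
  open Distances G connected

  edge-line⇒ : ∀ {p q z} → Adj p q → InLine G p q z → d p z ≢ d q z
  edge-line⇒ pq z∈pq = lineEq-edge-elim (subst (λ δ → LineEq δ _ _) (adj⇒d≡1 pq) (inLine⇒lineEq z∈pq))

  ⇒edge-line : ∀ {p q z} → Adj p q → d p z ≢ d q z → InLine G p q z
  ⇒edge-line {z = z} pq ne =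
    lineEq⇒inLine (subst (λ δ → LineEq δ _ _) (sym (adj⇒d≡1 pq)) (lineEq-edge-intro (near pq z) ne))

  same-lines⇒parity : ∀ {x c y} → Adj x c → Adj c y → SameLine G x c c y → ∀ z → Parity (d x z) (d y z)
  same-lines⇒parity xc cy same z = parity-transfer _ _ _ (near xc z) (near cy z)
    (λ ne → edge-line⇒ cy (Equivalence.to (same z) (⇒edge-line xc ne)))
    (λ ne → edge-line⇒ xc (Equivalence.from (same z) (⇒edge-line cy ne)))

  -- Suppose the line of an edge uv is the line of a good pair xy (with
  -- middle vertex c).  Then u and v have no common neighbour t: t is off
  -- the line uv = xy, so it is at one distance k ≥ 2 from both x and y;
  -- then u and v are at distance k ± 1 from x, and different ones since x
  -- lies on the line uv — but the ends of an edge cannot be two apart.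
  module SharedLine {u v x c y} (uv : Adj u v) (dist-xy : Dist G x y 2)
    (xc : Adj x c) (cy : Adj c y) (same : SameLine G x c c y)
    (lines : SameLine G u v x y) where

    dxy : d x y ≡ 2
    dxy = dist⇒d dist-xy

    xy-line⇒ : ∀ {z} → InLine G x y z → LineEq 2 (d x z) (d y z)
    xy-line⇒ = subst (λ δ → LineEq δ _ _) dxy ∘ inLine⇒lineEq

    ⇒xy-line : ∀ {z} → LineEq 2 (d x z) (d y z) → InLine G x y z
    ⇒xy-line = lineEq⇒inLine ∘ subst (λ δ → LineEq δ _ _) (sym dxy)

    parity : ∀ z → Parity (d x z) (d y z)
    parity = same-lines⇒parity xc cy same

    u∈uv : InLine G u v u
    u∈uv = ⇒edge-line uv λ eq → 0≢1+n (trans (sym (d-refl u)) (trans eq (adj⇒d≡1 (adj-sym uv))))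

    v∈uv : InLine G u v v
    v∈uv = ⇒edge-line uv λ eq → 1+n≢0 (trans (sym (adj⇒d≡1 uv)) (trans eq (d-refl v)))

    -- x lies on the line xy = uv, so it separates u from v.
    x-separates : d x u ≢ d x v
    x-separates eq = edge-line⇒ uv (Equivalence.from (lines x) (⇒xy-line (inj₁ x-on-xy)))
      (trans (d-sym u x) (trans eq (d-sym x v)))
      where
        x-on-xy : 2 ≡ d x x + d y x
        x-on-xy = trans (sym dxy) (trans (d-sym x y) (cong (_+ d y x) (sym (d-refl x))))

    module CommonNeighbour {t} (ut : Adj u t) (vt : Adj v t) where

      -- t is off the line uv, hence off the line xy.
      t∉xy : ¬ InLine G x y t
      t∉xy t∈xy = edge-line⇒ uv (Equivalence.from (lines t) t∈xy)
        (trans (adj⇒d≡1 ut) (sym (adj⇒d≡1 vt)))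

      xt≡yt : d x t ≡ d y t
      xt≡yt with d x t ≟ℕ d y t
      ... | yes eq = eq
      ... | no ne = ⊥-elim (t∉xy (⇒xy-line (lineEq-two-parity (parity t) ne)))

      xt≢1 : d x t ≢ 1
      xt≢1 eq = t∉xy (⇒xy-line (inj₁ (sym (cong₂ _+_ eq (trans (sym xt≡yt) eq)))))

      -- An end w of the edge is not at distance d(x, t) from x: otherwise it
      -- would also be at that distance from y, hence a common neighbour of
      -- x and y, making d(x, t) = 1.
      off-level : ∀ {w} → Adj w t → InLine G u v w → d x w ≢ d x t
      off-level {w} wt w∈uv xw≡xt = xt≢1 (trans (sym xw≡xt)
        (lineEq-two-equidistant (subst (LineEq 2 (d x w)) (sym xw≡yw)
          (xy-line⇒ (Equivalence.to (lines w) w∈uv)))))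
        where
          xw≡yw : d x w ≡ d y w
          xw≡yw = near-parity (subst (λ k → Near k (d y w)) (trans (sym xt≡yt) (sym xw≡xt))
                    (near′ (adj-sym wt) y)) (parity w)

      contradiction : ⊥
      contradiction =
        apart-around (d x t) (d x u) (d x v) (near′ (adj-sym ut) x) (near′ (adj-sym vt) x)
          (off-level ut u∈uv) (off-level vt v∈uv) x-separates (near′ uv x)

  no-common-neighbour : ∀ {u v x y} → Adj u v → GoodPair G x y → SameLine G u v x y →
    ∀ t → Adj u t → Adj v t → ⊥
  no-common-neighbour uv (dist-xy , c , xc , cy , same) lines t ut vt =
    SharedLine.CommonNeighbour.contradiction uv dist-xy xc cy same lines ut vt

  edge-line-universal :
    (∀ {u v z} → Adj u v → d u z ≡ d v z → ∃ λ t → Adj u t × Adj v t) →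
    ∀ {u v} → Adj u v → (∀ t → Adj u t → Adj v t → ⊥) → Universal G u v
  edge-line-universal common uv no-common z with d _ z ≟ℕ d _ z
  ... | no ne = ⇒edge-line uv ne
  ... | yes eq with common uv eq
  ...   | t , ut , vt = ⊥-elim (no-common t ut vt)

-- The line of the edge uv would be universal: u and v have no common
-- neighbour (SharedLine), and the triangle condition does the rest.
proposition4 : (G : Graph) → Connected G → HouseFree G → HoleFree G → NoUniversalLine G →
    ∀ u v x y → Graph.Adj G u v → GoodPair G x y → ¬ SameLine G u v x y
proposition4 G connected houseFree holeFree noUniversal u v x y uv good same =
  noUniversal u v u≢v
    (edge-line-universal equidistant⇒common-neighbour uv (no-common-neighbour uv good same))
  where
    open Graph G using (Adj; irrefl)
    open Lines G connected
    open TriangleCondition G connected houseFree holeFree using (equidistant⇒common-neighbour)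
    u≢v : u ≢ v
    u≢v u≡v = irrefl (subst (Adj u) (sym u≡v) uv)
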